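{- Consider the buffer management problem with packet values $v_1<\dots<v_m$ in which there is exactly one queue for each value $v_i$ (storing only $v_i$-packets) and all queues have the same capacity $B$. Let $r=\max_{1\le i\le m-1} v_i/v_{i+1}$. Then the online algorithm GREEDY is $(1+r)$-competitive, i.e., for every input sequence $\sigma$, $\mathrm{OPT}(\sigma)\le (1+r)\,\mathrm{GREEDY}(\sigma)$.
   Context: Model: packet values are non-negative numbers $v_1<\dots<v_m$. Time is discretized into unit steps. Packets arrive over time (at non-integral times), chosen by an adversary; a $v_i$-packet is destined for the $v_i$-queue. An arriving packet is either admitted to its queue (only if the queue holds fewer than $B$ packets) or rejected. At the end of each time step (a send event) at most one packet is taken from a non-empty queue and transmitted. The benefit of an algorithm on $\sigma$ is the sum of values of transmitted packets. $\mathrm{OPT}(\sigma)$ is the maximum benefit achievable by an offline algorithm knowing $\sigma$ in advance; $\mathrm{GREEDY}(\sigma)$ is GREEDY's benefit. GREEDY: accepts every arriving packet whose queue is not full, and at each send event sends a packet from the non-empty queue of highest value.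
   Formalization: The packet values $v_1<\dots<v_m$ are non-negative rationals rather than arbitrary non-negative numbers. -}

module Defs where

open import Data.Nat as ℕ using (ℕ; zero; suc)
open import Data.Integer using (+_)
open import Data.Fin as Fin using (Fin; zero; suc; inject₁; fromℕ)
open import Data.Maybe using (Maybe; just; nothing)
import Data.Maybe as Maybe
open import Data.List using (List; []; _∷_)
open import Data.Rational as ℚ using (ℚ; 0ℚ; _+_; _*_; _÷_; _⊔_)
open import Data.Rational.Properties using () renaming (_≟_ to _≟ℚ_)
open import Relation.Nullary using (yes; no)
open import Function using (_∘_)

-- Since all packets of a queue have the same value, the contents of the
-- buffer are described by the number of packets in each queue.
State : ℕ → Set
State m = Fin m → ℕ

empty : ∀ {m} → State m
empty _ = 0

adjust : ∀ {m} → State m → Fin m → (ℕ → ℕ) → State m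
adjust q i f j with i Fin.≟ j
... | yes _ = f (q j)
... | no _ = q j

-- An input sequence is a list of events: arrival of a packet destined for
-- queue i (value v i), or a send event (end of a unit time step).
-- Arrivals between two consecutive send events belong to the same time step.
data Event (m : ℕ) : Set where
  arrive : Fin m → Event m
  send   : Event m

ℕtoℚ : ℕ → ℚ
ℕtoℚ n = + n ℚ./ 1

sumFin : ∀ n → (Fin n → ℚ) → ℚ
sumFin zero f = 0ℚ
sumFin (suc n) f = f zero + sumFin n (f ∘ suc)

worth : ∀ {m} → (Fin m → ℚ) → State m → ℚ
worth {m} v q = sumFin m (λ i → ℕtoℚ (q i) * v i)

-- Executions of an arbitrary (offline) algorithm starting in buffer state q
-- on input σ, achieving benefit b.  After the input ends time continues
-- (send events go on forever), so every packet still buffered is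
-- eventually transmitted; its value is counted (constructor 'finish').
data Run {m : ℕ} (B : ℕ) (v : Fin m → ℚ) : State m → List (Event m) → ℚ → Set where
  finish : ∀ {q} → Run B v q [] (worth v q)
  accept : ∀ {q i σ b} → q i ℕ.< B →
           Run B v (adjust q i suc) σ b → Run B v q (arrive i ∷ σ) b
  reject : ∀ {q i σ b} → Run B v q σ b → Run B v q (arrive i ∷ σ) b
  idle   : ∀ {q σ b} → Run B v q σ b → Run B v q (send ∷ σ) b
  transmit : ∀ {q i σ b} → 0 ℕ.< q i →
           Run B v (adjust q i ℕ.pred) σ b → Run B v q (send ∷ σ) (v i + b)

-- highest-index (= highest-value, as values increase) non-empty queue
topNonEmpty : ∀ {m} → State m → Maybe (Fin m)
topNonEmpty {zero} q = nothing
topNonEmpty {suc m} q with q (fromℕ m)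
... | suc _ = just (fromℕ m)
... | zero = Maybe.map inject₁ (topNonEmpty {m} (q ∘ inject₁))

greedy : ∀ {m} → ℕ → (Fin m → ℚ) → State m → List (Event m) → ℚ
greedy B v q [] = worth v q
greedy B v q (arrive i ∷ σ) with q i ℕ.<? B
... | yes _ = greedy B v (adjust q i suc) σ
... | no _ = greedy B v q σ
greedy B v q (send ∷ σ) with topNonEmpty q
... | nothing = greedy B v q σ
... | just i = v i + greedy B v (adjust q i ℕ.pred) σ

-- total division on ℚ (only used with nonzero denominators below)
div : ℚ → ℚ → ℚ
div a b with b ≟ℚ 0ℚ
... | yes _ = 0ℚ
... | no b≢0 = _÷_ a b {{ℚ.≢-nonZero b≢0}}

maxOver : ∀ n → (Fin (suc n) → ℚ) → ℚ
maxOver zero f = f zero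
maxOver (suc n) f = f zero ⊔ maxOver n (f ∘ suc)

-- r = max_{1 ≤ i ≤ m-1} v_i / v_{i+1}, for m = k + 2 values
ratioMax : ∀ k → (Fin (suc (suc k)) → ℚ) → ℚ
ratioMax k v = maxOver k (λ i → div (v (inject₁ i)) (v (suc i)))

module Submission where

open import Defs
open import Data.Nat using (ℕ; suc)
open import Data.Fin using (Fin; zero; suc; inject₁)
open import Data.List using (List)
open import Data.Rational using (ℚ; 0ℚ; 1ℚ; _+_; _*_; _≤_; _<_)

import Data.Nat as ℕ
import Data.Nat.Properties as ℕP
import Data.Fin as F
import Data.Fin.Properties as FP
open import Data.Fin.Relation.Unary.Top using (view; ‵fromℕ; ‵inj₁)
open import Data.Integer using () renaming (+_ to ⁺_)
import Data.Integer as ℤ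
import Data.Integer.Properties as ℤP
open import Data.Rational using (toℚᵘ; 1/_; ≢-nonZero; nonNegative; positive)
open import Data.Rational.Properties
import Data.Rational.Unnormalised as ℚᵘ
import Data.Rational.Unnormalised.Properties as ℚᵘP
open import Data.Rational.Solver using (module +-*-Solver)
open import Data.Maybe using (just; nothing)
open import Relation.Binary.Definitions using (tri<; tri≈; tri>)
open import Relation.Nullary using (yes; no)
open import Relation.Nullary.Negation using (contradiction)
open import Relation.Binary.PropositionalEquality
open import Function using (_∘_)

-- Compare an arbitrary run with GREEDY through the potential Φ(qo, qg): the
-- total value of the packets the run (buffer qo) holds in excess of GREEDY
-- (buffer qg), queue by queue.  Invariant: the remaining benefit of the run is
-- at most (1 + r) times the remaining benefit of GREEDY plus Φ.  Φ starts at
-- 0 and every event preserves the invariant.  A packet accepted by the run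
-- but rejected by GREEDY meets a full GREEDY queue, so it creates no excess.
-- When GREEDY sends a v_i-packet, Φ grows by at most v_i.  When the run sends
-- a v_j-packet, either that packet was in excess (GREEDY is idle, or sends
-- from a queue i < j while all of its queues above i are empty), or i = j,
-- or j < i and v_j ≤ r v_i.

ℕtoℚ-+ : ∀ a b → ℕtoℚ (a ℕ.+ b) ≡ ℕtoℚ a + ℕtoℚ b
ℕtoℚ-+ a b = toℚᵘ-injective (begin
    toℚᵘ (ℕtoℚ (a ℕ.+ b))             ≈⟨ toℚᵘ-fromℚᵘ (ℕtoℚᵘ (a ℕ.+ b)) ⟩
    ℕtoℚᵘ (a ℕ.+ b)                   ≈⟨ ℚᵘ.*≡* numerators ⟩
    ℕtoℚᵘ a ℚᵘ.+ ℕtoℚᵘ b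
      ≈⟨ ℚᵘP.+-cong (toℚᵘ-fromℚᵘ (ℕtoℚᵘ a)) (toℚᵘ-fromℚᵘ (ℕtoℚᵘ b)) ⟨
    toℚᵘ (ℕtoℚ a) ℚᵘ.+ toℚᵘ (ℕtoℚ b)  ≈⟨ toℚᵘ-homo-+ (ℕtoℚ a) (ℕtoℚ b) ⟨
    toℚᵘ (ℕtoℚ a + ℕtoℚ b)            ∎)
  where
  open ℚᵘP.≃-Reasoning
  ℕtoℚᵘ : ℕ → ℚᵘ.ℚᵘ
  ℕtoℚᵘ n = ℚᵘ.mkℚᵘ (⁺ n) 0
  numerators : ⁺ (a ℕ.+ b) ℤ.* ⁺ 1 ≡ (⁺ a ℤ.* ⁺ 1 ℤ.+ ⁺ b ℤ.* ⁺ 1) ℤ.* ⁺ 1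
  numerators = trans (ℤP.*-identityʳ _) (trans (ℤP.pos-+ a b) (sym (trans (ℤP.*-identityʳ _)
                 (cong₂ ℤ._+_ (ℤP.*-identityʳ (⁺ a)) (ℤP.*-identityʳ (⁺ b))))))

ℕtoℚ-nonNeg : ∀ n → 0ℚ ≤ ℕtoℚ n
ℕtoℚ-nonNeg n = nonNegative⁻¹ (ℕtoℚ n) {{normalize-nonNeg n 1}}

ℕtoℚ-mono-≤ : ∀ {a b} → a ℕ.≤ b → ℕtoℚ a ≤ ℕtoℚ b
ℕtoℚ-mono-≤ {a} {b} a≤b = begin
    ℕtoℚ a                       ≡⟨ sym (+-identityʳ (ℕtoℚ a)) ⟩
    ℕtoℚ a + 0ℚ                  ≤⟨ +-monoʳ-≤ (ℕtoℚ a) (ℕtoℚ-nonNeg (b ℕ.∸ a)) ⟩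
    ℕtoℚ a + ℕtoℚ (b ℕ.∸ a)      ≡⟨ sym (ℕtoℚ-+ a (b ℕ.∸ a)) ⟩
    ℕtoℚ (a ℕ.+ (b ℕ.∸ a))       ≡⟨ cong ℕtoℚ (ℕP.m+[n∸m]≡n a≤b) ⟩
    ℕtoℚ b                       ∎
  where open ≤-Reasoning

sumFin-cong : ∀ n {f g : Fin n → ℚ} → (∀ i → f i ≡ g i) → sumFin n f ≡ sumFin n g
sumFin-cong ℕ.zero    f≡g = refl
sumFin-cong (suc n) f≡g = cong₂ _+_ (f≡g zero) (sumFin-cong n (f≡g ∘ suc))

sumFin-mono-≤ : ∀ n {f g : Fin n → ℚ} → (∀ i → f i ≤ g i) → sumFin n f ≤ sumFin n g
sumFin-mono-≤ ℕ.zero    f≤g = ≤-refl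
sumFin-mono-≤ (suc n) f≤g = +-mono-≤ (f≤g zero) (sumFin-mono-≤ n (f≤g ∘ suc))

sumFin-+ : ∀ n (f g : Fin n → ℚ) → sumFin n (λ i → f i + g i) ≡ sumFin n f + sumFin n g
sumFin-+ ℕ.zero    f g = refl
sumFin-+ (suc n) f g = trans (cong (f zero + g zero +_) (sumFin-+ n (f ∘ suc) (g ∘ suc)))
  (solve 4 (λ a b c d → (a :+ b) :+ (c :+ d) := (a :+ c) :+ (b :+ d)) refl
     (f zero) (g zero) (sumFin n (f ∘ suc)) (sumFin n (g ∘ suc)))
  where open +-*-Solver

sumFin-add-at : ∀ n (f g : Fin n → ℚ) c i → g i ≡ c + f i → (∀ j → i ≢ j → g j ≡ f j) →
                sumFin n g ≡ c + sumFin n f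
sumFin-add-at (suc n) f g c zero gi≡c+fi g≡f =
  trans (cong₂ _+_ gi≡c+fi (sumFin-cong n (λ j → g≡f (suc j) (λ ()))))
        (+-assoc c (f zero) (sumFin n (f ∘ suc)))
sumFin-add-at (suc n) f g c (suc i) gi≡c+fi g≡f =
  trans (cong₂ _+_ (g≡f zero (λ ()))
                   (sumFin-add-at n (f ∘ suc) (g ∘ suc) c i gi≡c+fi
                      (λ j i≢j → g≡f (suc j) (i≢j ∘ FP.suc-injective))))
        (solve 3 (λ a c s → a :+ (c :+ s) := c :+ (a :+ s)) refl (f zero) c (sumFin n (f ∘ suc)))
  where open +-*-Solver

adjust-same : ∀ {m} (q : State m) i f → adjust q i f i ≡ f (q i)
adjust-same q i f with i F.≟ i
... | yes _  = refl
... | no i≢i = contradiction refl i≢i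

adjust-other : ∀ {m} (q : State m) i f j → i ≢ j → adjust q i f j ≡ q j
adjust-other q i f j i≢j with i F.≟ j
... | yes i≡j = contradiction i≡j i≢j
... | no _    = refl

adjust-pred-≤ : ∀ {m} (q : State m) i j → adjust q i ℕ.pred j ℕ.≤ q j
adjust-pred-≤ q i j with i F.≟ j
... | yes refl = ℕP.pred[n]≤n
... | no _     = ℕP.≤-refl

worth-empty : ∀ {m} (v : Fin m → ℚ) → worth v empty ≡ 0ℚ
worth-empty {ℕ.zero}  v = refl
worth-empty {suc m} v = trans (cong₂ _+_ (*-zeroˡ (v zero)) (worth-empty (v ∘ suc))) (+-identityˡ 0ℚ)

worth-+ : ∀ {m} (v : Fin m → ℚ) (a b : State m) →
          worth v (λ i → a i ℕ.+ b i) ≡ worth v a + worth v b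
worth-+ {m} v a b = trans (sumFin-cong m distrib) (sumFin-+ m _ _)
  where
  distrib : ∀ i → ℕtoℚ (a i ℕ.+ b i) * v i ≡ ℕtoℚ (a i) * v i + ℕtoℚ (b i) * v i
  distrib i = trans (cong (_* v i) (ℕtoℚ-+ (a i) (b i))) (*-distribʳ-+ (v i) (ℕtoℚ (a i)) (ℕtoℚ (b i)))

worth-suc : ∀ {m} (v : Fin m → ℚ) (q : State m) i → worth v (adjust q i suc) ≡ v i + worth v q
worth-suc {m} v q i = sumFin-add-at m _ _ (v i) i
  (begin
    ℕtoℚ (adjust q i suc i) * v i    ≡⟨ cong (λ n → ℕtoℚ n * v i) (adjust-same q i suc) ⟩
    ℕtoℚ (1 ℕ.+ q i) * v i           ≡⟨ cong (_* v i) (ℕtoℚ-+ 1 (q i)) ⟩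
    (1ℚ + ℕtoℚ (q i)) * v i          ≡⟨ *-distribʳ-+ (v i) 1ℚ (ℕtoℚ (q i)) ⟩
    1ℚ * v i + ℕtoℚ (q i) * v i      ≡⟨ cong (_+ ℕtoℚ (q i) * v i) (*-identityˡ (v i)) ⟩
    v i + ℕtoℚ (q i) * v i           ∎)
  (λ j i≢j → cong (λ n → ℕtoℚ n * v j) (adjust-other q i suc j i≢j))
  where open ≡-Reasoning

topNonEmpty-nothing : ∀ {m} (q : State m) → topNonEmpty q ≡ nothing → ∀ l → q l ≡ 0
topNonEmpty-nothing {suc m} q top l with q (F.fromℕ m) in top-empty
topNonEmpty-nothing {suc m} q () l | suc _
... | ℕ.zero with topNonEmpty (q ∘ inject₁) in rest
topNonEmpty-nothing {suc m} q () l | ℕ.zero | just _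
... | nothing with view l
...   | ‵fromℕ          = top-empty
...   | ‵inj₁ {i = l′} _ = topNonEmpty-nothing (q ∘ inject₁) rest l′

topNonEmpty-just : ∀ {m} (q : State m) {i} → topNonEmpty q ≡ just i → 0 ℕ.< q i
topNonEmpty-just {suc m} q top with q (F.fromℕ m) in top-full
topNonEmpty-just {suc m} q refl | suc _ = subst (0 ℕ.<_) (sym top-full) (ℕ.s≤s ℕ.z≤n)
... | ℕ.zero with topNonEmpty (q ∘ inject₁) in rest
topNonEmpty-just {suc m} q ()   | ℕ.zero | nothing
topNonEmpty-just {suc m} q refl | ℕ.zero | just _ = topNonEmpty-just (q ∘ inject₁) rest

topNonEmpty-above : ∀ {m} (q : State m) {i l} → topNonEmpty q ≡ just i → i F.< l → q l ≡ 0
topNonEmpty-above {suc m} q top i<l with q (F.fromℕ m) in top-full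
topNonEmpty-above {suc m} q {l = l} refl i<l | suc _ = contradiction (FP.≤fromℕ l) (ℕP.<⇒≱ i<l)
... | ℕ.zero with topNonEmpty (q ∘ inject₁) in rest
topNonEmpty-above {suc m} q ()   i<l | ℕ.zero | nothing
topNonEmpty-above {suc m} q {l = l} refl i<l | ℕ.zero | just i′ with view l
... | ‵fromℕ          = top-full
... | ‵inj₁ {i = l′} _ = topNonEmpty-above (q ∘ inject₁) rest
                           (subst₂ ℕ._<_ (FP.toℕ-inject₁ i′) (FP.toℕ-inject₁ l′) i<l)

m∸pred[n]≤1+m∸n : ∀ m n → m ℕ.∸ ℕ.pred n ℕ.≤ suc (m ℕ.∸ n)
m∸pred[n]≤1+m∸n m        ℕ.zero          = ℕP.n≤1+n m
m∸pred[n]≤1+m∸n ℕ.zero   (suc n)         rewrite ℕP.0∸n≡0 n = ℕ.z≤n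
m∸pred[n]≤1+m∸n (suc m)  (suc ℕ.zero)    = ℕP.≤-refl
m∸pred[n]≤1+m∸n (suc m)  (suc (suc n))   = m∸pred[n]≤1+m∸n m (suc n)

1+pred[m]∸n≡m∸n : ∀ {m n} → n ℕ.< m → suc (ℕ.pred m ℕ.∸ n) ≡ m ℕ.∸ n
1+pred[m]∸n≡m∸n (ℕ.s≤s n≤m) = sym (ℕP.+-∸-assoc 1 n≤m)

pred[m]∸pred[n]≡m∸n : ∀ {m n} → 0 ℕ.< m → 0 ℕ.< n → ℕ.pred m ℕ.∸ ℕ.pred n ≡ m ℕ.∸ n
pred[m]∸pred[n]≡m∸n {suc m} {suc n} _ _ = refl

excess : ∀ {m} → State m → State m → State m
excess qo qg l = qo l ℕ.∸ qg l

module _ {m : ℕ} (qo qg : State m) where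

  excess-accept-both : ∀ i l → excess (adjust qo i suc) (adjust qg i suc) l ℕ.≤ excess qo qg l
  excess-accept-both i l with i F.≟ l
  ... | yes refl = ℕP.≤-refl
  ... | no _     = ℕP.≤-refl

  excess-accept-below : ∀ i → qo i ℕ.< qg i → ∀ l →
                        excess (adjust qo i suc) qg l ℕ.≤ excess qo qg l
  excess-accept-below i qoᵢ<qgᵢ l with i F.≟ l
  ... | yes refl rewrite ℕP.m≤n⇒m∸n≡0 qoᵢ<qgᵢ = ℕ.z≤n
  ... | no _     = ℕP.≤-refl

  excess-greedy-accepts : ∀ i l → excess qo (adjust qg i suc) l ℕ.≤ excess qo qg l
  excess-greedy-accepts i l with i F.≟ l
  ... | yes refl = ℕP.∸-monoʳ-≤ (qo i) (ℕP.n≤1+n (qg i))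
  ... | no _     = ℕP.≤-refl

  excess-greedy-sends : ∀ i l → excess qo (adjust qg i ℕ.pred) l ℕ.≤ adjust (excess qo qg) i suc l
  excess-greedy-sends i l with i F.≟ l
  ... | yes refl = m∸pred[n]≤1+m∸n (qo i) (qg i)
  ... | no _     = ℕP.≤-refl

  excess-run-sends : ∀ j l → excess (adjust qo j ℕ.pred) qg l ℕ.≤ excess qo qg l
  excess-run-sends j l = ℕP.∸-monoˡ-≤ (qg l) (adjust-pred-≤ qo j l)

  excess-run-sends-excess : ∀ j → qg j ℕ.< qo j → ∀ l →
                            adjust (excess (adjust qo j ℕ.pred) qg) j suc l ℕ.≤ excess qo qg l
  excess-run-sends-excess j qgⱼ<qoⱼ l with j F.≟ l
  ... | yes refl rewrite adjust-same qo j ℕ.pred = ℕP.≤-reflexive (1+pred[m]∸n≡m∸n qgⱼ<qoⱼ)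
  ... | no j≢l   rewrite adjust-other qo j ℕ.pred l j≢l = ℕP.≤-refl

  excess-both-send : ∀ i → 0 ℕ.< qo i → 0 ℕ.< qg i → ∀ l →
                     excess (adjust qo i ℕ.pred) (adjust qg i ℕ.pred) l ℕ.≤ excess qo qg l
  excess-both-send i qoᵢ>0 qgᵢ>0 l with i F.≟ l
  ... | yes refl = ℕP.≤-reflexive (pred[m]∸pred[n]≡m∸n qoᵢ>0 qgᵢ>0)
  ... | no _     = ℕP.≤-refl

module Potential {m : ℕ} (v : Fin m → ℚ) (v≥0 : ∀ i → 0ℚ ≤ v i) where

  worth-mono-≤ : ∀ {a b : State m} → (∀ l → a l ℕ.≤ b l) → worth v a ≤ worth v b
  worth-mono-≤ a≤b =
    sumFin-mono-≤ m (λ l → *-monoʳ-≤-nonNeg (v l) {{nonNegative (v≥0 l)}} (ℕtoℚ-mono-≤ (a≤b l)))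

  worth-nonNeg : ∀ q → 0ℚ ≤ worth v q
  worth-nonNeg q = subst (_≤ worth v q) (worth-empty v) (worth-mono-≤ {empty} {q} (λ _ → ℕ.z≤n))

  Φ : State m → State m → ℚ
  Φ qo qg = worth v (excess qo qg)

  worth≤worth+Φ : ∀ qo qg → worth v qo ≤ worth v qg + Φ qo qg
  worth≤worth+Φ qo qg = subst (worth v qo ≤_) (worth-+ v qg (excess qo qg))
                          (worth-mono-≤ (λ l → ℕP.m≤n+m∸n (qo l) (qg l)))

  Φ-greedy-sends : ∀ qo qg i → Φ qo (adjust qg i ℕ.pred) ≤ v i + Φ qo qg
  Φ-greedy-sends qo qg i = subst (Φ qo (adjust qg i ℕ.pred) ≤_) (worth-suc v (excess qo qg) i)
                             (worth-mono-≤ (excess-greedy-sends qo qg i))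

  Φ-run-sends-excess : ∀ qo qg j → qg j ℕ.< qo j → v j + Φ (adjust qo j ℕ.pred) qg ≤ Φ qo qg
  Φ-run-sends-excess qo qg j qgⱼ<qoⱼ =
    subst (_≤ Φ qo qg) (worth-suc v (excess (adjust qo j ℕ.pred) qg) j)
      (worth-mono-≤ (excess-run-sends-excess qo qg j qgⱼ<qoⱼ))

stepwise-mono-≤ : ∀ {n} (f : Fin (suc n) → ℚ) → (∀ i → f (inject₁ i) ≤ f (suc i)) →
                  ∀ {a b} → a F.≤ b → f a ≤ f b
stepwise-mono-≤ f step {zero} {zero} _ = ≤-refl
stepwise-mono-≤ {suc _} f step {zero} {suc b} _ =
  ≤-trans (step zero) (stepwise-mono-≤ (f ∘ suc) (step ∘ suc) {zero} {b} ℕ.z≤n)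
stepwise-mono-≤ {suc _} f step {suc a} {suc b} (ℕ.s≤s a≤b) =
  stepwise-mono-≤ (f ∘ suc) (step ∘ suc) a≤b

div[p,q]*q≡p : ∀ p q → 0ℚ < q → div p q * q ≡ p
div[p,q]*q≡p p q q>0 with q ≟ 0ℚ
... | yes refl = contradiction q>0 (<-irrefl refl)
... | no q≢0   = trans (*-assoc p ((1/ q) {{≢-nonZero q≢0}}) q)
                   (trans (cong (p *_) (*-inverseˡ q {{≢-nonZero q≢0}})) (*-identityʳ p))

≤maxOver : ∀ n (f : Fin (suc n) → ℚ) i → f i ≤ maxOver n f
≤maxOver ℕ.zero  f zero    = ≤-refl
≤maxOver (suc n) f zero    = p≤p⊔q (f zero) (maxOver n (f ∘ suc))
≤maxOver (suc n) f (suc i) = p≤q⇒p≤r⊔q (f zero) (≤maxOver n (f ∘ suc) i)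

module Ratio (k : ℕ) (v : Fin (suc (suc k)) → ℚ) (v₀≥0 : 0ℚ ≤ v zero)
             (increasing : ∀ (i : Fin (suc k)) → v (inject₁ i) < v (suc i)) where

  r : ℚ
  r = ratioMax k v

  v-mono-≤ : ∀ {a b} → a F.≤ b → v a ≤ v b
  v-mono-≤ = stepwise-mono-≤ v (<⇒≤ ∘ increasing)

  v≥0 : ∀ i → 0ℚ ≤ v i
  v≥0 i = ≤-trans v₀≥0 (v-mono-≤ ℕ.z≤n)

  v-step : ∀ p → v (inject₁ p) ≤ r * v (suc p)
  v-step p = subst (_≤ r * v (suc p)) (div[p,q]*q≡p (v (inject₁ p)) (v (suc p)) vₚ₊₁>0)
    (*-monoʳ-≤-nonNeg (v (suc p)) {{nonNegative (v≥0 (suc p))}}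
      (≤maxOver k (λ i → div (v (inject₁ i)) (v (suc i))) p))
    where
    vₚ₊₁>0 : 0ℚ < v (suc p)
    vₚ₊₁>0 = ≤-<-trans (v≥0 (inject₁ p)) (increasing p)

  r≥0 : 0ℚ ≤ r
  r≥0 = *-cancelʳ-≤-pos (v (suc zero)) {{positive (≤-<-trans v₀≥0 (increasing zero))}}
          (subst (_≤ r * v (suc zero)) (sym (*-zeroˡ (v (suc zero)))) (≤-trans v₀≥0 (v-step zero)))

  v-below : ∀ {j i} → j F.< i → v j ≤ r * v i
  v-below {j} {suc p} (ℕ.s≤s j≤p) =
    ≤-trans (v-mono-≤ (subst (F.toℕ j ℕ.≤_) (sym (FP.toℕ-inject₁ p)) j≤p)) (v-step p)

module Competitive {m : ℕ} (B : ℕ) (v : Fin m → ℚ) (v≥0 : ∀ i → 0ℚ ≤ v i)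
                   (r : ℚ) (r≥0 : 0ℚ ≤ r) (v-below : ∀ {j i} → j F.< i → v j ≤ r * v i) where
  open Potential v v≥0
  open +-*-Solver

  R : ℚ
  R = 1ℚ + r

  x≤R*x : ∀ {x} → 0ℚ ≤ x → x ≤ R * x
  x≤R*x {x} x≥0 = begin
      x          ≡⟨ sym (+-identityʳ x) ⟩
      x + 0ℚ     ≤⟨ +-monoʳ-≤ x r*x≥0 ⟩
      x + r * x  ≡⟨ solve 2 (λ r x → x :+ r :* x := (con 1ℚ :+ r) :* x) refl r x ⟩
      R * x      ∎
    where
    open ≤-Reasoning
    r*x≥0 : 0ℚ ≤ r * x
    r*x≥0 = nonNegative⁻¹ (r * x) {{nonNeg*nonNeg⇒nonNeg r {{nonNegative r≥0}} x {{nonNegative x≥0}}}}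

  charge : ∀ {i y Φ₀} → y ≤ v i + Φ₀ → y ≤ R * v i + Φ₀
  charge {i} {Φ₀ = Φ₀} y≤vᵢ+Φ₀ = ≤-trans y≤vᵢ+Φ₀ (+-monoˡ-≤ Φ₀ (x≤R*x (v≥0 i)))

  amortise : ∀ a {b g G Φ′ Φ₀} → b ≤ R * G + Φ′ → a + Φ′ ≤ R * g + Φ₀ →
             a + b ≤ R * (g + G) + Φ₀
  amortise a {b} {g} {G} {Φ′} {Φ₀} b≤ a+Φ′≤ = begin
      a + b                 ≤⟨ +-monoʳ-≤ a b≤ ⟩
      a + (R * G + Φ′)      ≡⟨ solve 3 (λ a x y → a :+ (x :+ y) := x :+ (a :+ y)) refl a (R * G) Φ′ ⟩
      R * G + (a + Φ′)      ≤⟨ +-monoʳ-≤ (R * G) a+Φ′≤ ⟩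
      R * G + (R * g + Φ₀)
        ≡⟨ solve 4 (λ R G g f → R :* G :+ (R :* g :+ f) := R :* (g :+ G) :+ f) refl R G g Φ₀ ⟩
      R * (g + G) + Φ₀      ∎
    where open ≤-Reasoning

  amortise-run-idle : ∀ {b g G Φ′ Φ₀} → b ≤ R * G + Φ′ → Φ′ ≤ R * g + Φ₀ →
                      b ≤ R * (g + G) + Φ₀
  amortise-run-idle {b} {Φ′ = Φ′} b≤ Φ′≤ =
    subst (_≤ _) (+-identityˡ b) (amortise 0ℚ b≤ (subst (_≤ _) (sym (+-identityˡ Φ′)) Φ′≤))

  amortise-greedy-idle : ∀ a {b G Φ′ Φ₀} → b ≤ R * G + Φ′ → a + Φ′ ≤ Φ₀ → a + b ≤ R * G + Φ₀
  amortise-greedy-idle a {b} {G} {Φ′} {Φ₀} b≤ a+Φ′≤ = begin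
      a + b             ≤⟨ +-monoʳ-≤ a b≤ ⟩
      a + (R * G + Φ′)  ≡⟨ solve 3 (λ a x y → a :+ (x :+ y) := x :+ (a :+ y)) refl a (R * G) Φ′ ⟩
      R * G + (a + Φ′)  ≤⟨ +-monoʳ-≤ (R * G) a+Φ′≤ ⟩
      R * G + Φ₀        ∎
    where open ≤-Reasoning

  lower-potential : ∀ {b G Φ′ Φ₀} → b ≤ R * G + Φ′ → Φ′ ≤ Φ₀ → b ≤ R * G + Φ₀
  lower-potential {G = G} b≤ Φ′≤Φ₀ = ≤-trans b≤ (+-monoʳ-≤ (R * G) Φ′≤Φ₀)

  both-send : ∀ qo qg {i} j → topNonEmpty qg ≡ just i → 0 ℕ.< qo j →
              v j + Φ (adjust qo j ℕ.pred) (adjust qg i ℕ.pred) ≤ R * v i + Φ qo qg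
  both-send qo qg {i} j top qoⱼ>0 with FP.<-cmp j i
  ... | tri< j<i _ _ = begin
      v j + Φ (adjust qo j ℕ.pred) (adjust qg i ℕ.pred)
        ≤⟨ +-monoʳ-≤ (v j) (worth-mono-≤ (excess-run-sends qo (adjust qg i ℕ.pred) j)) ⟩
      v j + Φ qo (adjust qg i ℕ.pred)   ≤⟨ +-monoʳ-≤ (v j) (Φ-greedy-sends qo qg i) ⟩
      v j + (v i + Φ qo qg)             ≤⟨ +-monoˡ-≤ (v i + Φ qo qg) (v-below j<i) ⟩
      r * v i + (v i + Φ qo qg)
        ≡⟨ solve 3 (λ r x f → r :* x :+ (x :+ f) := (con 1ℚ :+ r) :* x :+ f) refl r (v i) (Φ qo qg) ⟩
      R * v i + Φ qo qg                 ∎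
    where open ≤-Reasoning
  ... | tri≈ _ refl _ = charge (+-monoʳ-≤ (v i)
                          (worth-mono-≤ (excess-both-send qo qg i qoⱼ>0 (topNonEmpty-just qg top))))
  ... | tri> _ _ i<j = charge (≤-trans (Φ-run-sends-excess qo (adjust qg i ℕ.pred) j qgⱼ<qoⱼ)
                                       (Φ-greedy-sends qo qg i))
    where
    qgⱼ<qoⱼ : adjust qg i ℕ.pred j ℕ.< qo j
    qgⱼ<qoⱼ rewrite adjust-other qg i ℕ.pred j (λ { refl → ℕP.<-irrefl refl i<j })
                  | topNonEmpty-above qg top i<j = qoⱼ>0

  invariant : ∀ {qo σ b} → Run B v qo σ b → ∀ qg → b ≤ R * greedy B v qg σ + Φ qo qg
  invariant {qo} finish qg =
    ≤-trans (worth≤worth+Φ qo qg) (+-monoˡ-≤ (Φ qo qg) (x≤R*x (worth-nonNeg qg)))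
  invariant {qo} (accept {i = i} qoᵢ<B run) qg with qg i ℕ.<? B
  ... | yes _    = lower-potential (invariant run (adjust qg i suc))
                     (worth-mono-≤ (excess-accept-both qo qg i))
  ... | no qgᵢ≮B = lower-potential (invariant run qg)
                     (worth-mono-≤ (excess-accept-below qo qg i (ℕP.<-≤-trans qoᵢ<B (ℕP.≮⇒≥ qgᵢ≮B))))
  invariant {qo} (reject {i = i} run) qg with qg i ℕ.<? B
  ... | yes _ = lower-potential (invariant run (adjust qg i suc))
                  (worth-mono-≤ (excess-greedy-accepts qo qg i))
  ... | no _  = invariant run qg
  invariant {qo} (idle run) qg with topNonEmpty qg
  ... | nothing = invariant run qg
  ... | just i  = amortise-run-idle (invariant run (adjust qg i ℕ.pred)) (charge (Φ-greedy-sends qo qg i))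
  invariant {qo} (transmit {i = j} qoⱼ>0 run) qg with topNonEmpty qg in top
  ... | nothing = amortise-greedy-idle (v j) (invariant run qg) (Φ-run-sends-excess qo qg j qgⱼ<qoⱼ)
    where
    qgⱼ<qoⱼ : qg j ℕ.< qo j
    qgⱼ<qoⱼ rewrite topNonEmpty-nothing qg top j = qoⱼ>0
  ... | just i  = amortise (v j) (invariant run (adjust qg i ℕ.pred)) (both-send qo qg j top qoⱼ>0)

theorem2 : (k B : ℕ) (v : Fin (suc (suc k)) → ℚ) →
           0ℚ ≤ v zero →
           (∀ (i : Fin (suc k)) → v (inject₁ i) < v (suc i)) →
           (σ : List (Event (suc (suc k)))) (b : ℚ) →
           Run B v empty σ b →
           b ≤ (1ℚ + ratioMax k v) * greedy B v empty σ
theorem2 k B v v₀≥0 increasing σ b run =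
  subst (b ≤_) (trans (cong (G +_) (worth-empty v)) (+-identityʳ G)) (invariant run empty)
  where
  open Ratio k v v₀≥0 increasing
  open Competitive B v v≥0 r r≥0 v-below
  G : ℚ
  G = R * greedy B v empty σ
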